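{- Let $A\in\mathbb{R}^{n\times n}$ be the adjacency matrix of a finite directed weighted graph $G=(V,E,\Omega)$ without loops, with positive edge weights, so $A_{ij}=\Omega((i,j))>0$ if $(i,j)\in E$ and $A_{ij}=0$ otherwise, and $A_{ii}=0$. For $k\ge 0$ let $p_k(A)\in\mathbb{R}^{n\times n}$ be the matrix whose $(i,j)$ entry is the sum of the weights of all nonbacktracking walks of length $k$ from node $i$ to node $j$, with $p_0(A)=I$. Then for all $k\ge 1$, \[ p_k(A) = \sum_{\substack{\ell=2h+1 \text{ odd} \\ 1 \leq \ell \leq k}} \bigl(A^{\circ (h+1)} \circ (A^T)^{\circ h} \bigr)\, p_{k-\ell}(A) \;-\; \sum_{\substack{\ell=2h \text{ even} \\ 2 \leq \ell \leq k}} \operatorname{dd}\!\bigl((A^{\circ h})^2\bigr)\, p_{k-\ell}(A). \]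
   Context: A walk of length $\ell$ is a sequence of nodes $i_1,\dots,i_{\ell+1}$ with $(i_j,i_{j+1})\in E$ for all $j$; its weight is $\prod_{j=1}^{\ell} A_{i_j i_{j+1}}$. A walk is nonbacktracking if its node sequence contains no consecutive subsequence of the form $i\,j\,i$. $X\circ Y$ is the elementwise (Hadamard) product, $X^{\circ k}$ the elementwise $k$-th power ($(X^{\circ k})_{ij}=(X_{ij})^k$), with the convention that $X^{\circ 0}=\mathbf{1}\mathbf{1}^T$ is the all-ones matrix. $\operatorname{dd}(X)$ denotes the diagonal matrix with the same diagonal entries as $X$. Products written without $\circ$ are ordinary matrix products. -}

module Defs where

open import Level using (Level; _⊔_)
open import Algebra.Bundles using (CommutativeRing)
open import Data.Nat as ℕ using (ℕ; zero; suc; _∸_; _%_; _/_)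
open import Data.Fin using (Fin; zero; suc) renaming (_≟_ to _≟ᶠ_)
open import Data.Vec using (Vec; []; _∷_; head; last)
open import Data.List using (List; []; _∷_; [_]; map; concatMap; filter; foldr; allFin; upTo)
open import Data.Product using (_×_; _,_)
open import Data.Unit.Polymorphic using (⊤)
open import Relation.Nullary using (¬_; Dec; yes; no)
open import Relation.Nullary.Decidable using (_×-dec_; ¬?)
open import Relation.Binary.PropositionalEquality using (_≡_)
import Data.Unit.Polymorphic.Properties as ⊤P

module Mat {c ℓ} (R : CommutativeRing c ℓ) where
  open CommutativeRing R hiding (zero)

  Matrix : ℕ → Set c
  Matrix n = Fin n → Fin n → Carrier

  _≈ᴹ_ : ∀ {n} → Matrix n → Matrix n → Set ℓ
  M ≈ᴹ N = ∀ i j → M i j ≈ N i j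

  sumFin : ∀ {n} → (Fin n → Carrier) → Carrier
  sumFin {zero}  f = 0#
  sumFin {suc n} f = f zero + sumFin (λ i → f (suc i))

  sumList : List Carrier → Carrier
  sumList = foldr _+_ 0#

  pow : Carrier → ℕ → Carrier
  pow x zero    = 1#
  pow x (suc k) = x * pow x k

  zeroᴹ : ∀ {n} → Matrix n
  zeroᴹ i j = 0#

  _+ᴹ_ : ∀ {n} → Matrix n → Matrix n → Matrix n
  (M +ᴹ N) i j = M i j + N i j

  _-ᴹ_ : ∀ {n} → Matrix n → Matrix n → Matrix n
  (M -ᴹ N) i j = M i j - N i j

  _·ᴹ_ : ∀ {n} → Matrix n → Matrix n → Matrix n
  (M ·ᴹ N) i j = sumFin (λ k → M i k * N k j)

  _∘ᴹ_ : ∀ {n} → Matrix n → Matrix n → Matrix n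
  (M ∘ᴹ N) i j = M i j * N i j

  -- Hadamard power (X^{∘0} is the all-ones matrix)
  hpow : ∀ {n} → Matrix n → ℕ → Matrix n
  hpow M k i j = pow (M i j) k

  transpose : ∀ {n} → Matrix n → Matrix n
  transpose M i j = M j i

  dd : ∀ {n} → Matrix n → Matrix n
  dd M i j with i ≟ᶠ j
  ... | yes _ = M i i
  ... | no  _ = 0#

  sumᴹ : ∀ {n} → List (Matrix n) → Matrix n
  sumᴹ = foldr _+ᴹ_ zeroᴹ

  adjacency : ∀ {n e} (E : Fin n → Fin n → Set e)
              (E? : ∀ i j → Dec (E i j)) (Ω : ∀ i j → E i j → Carrier) → Matrix n
  adjacency E E? Ω i j with E? i j
  ... | yes e = Ω i j e
  ... | no  _ = 0#

  IsWalk : ∀ {n e m} (E : Fin n → Fin n → Set e) → Vec (Fin n) m → Set e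
  IsWalk E (x ∷ y ∷ xs) = E x y × IsWalk E (y ∷ xs)
  IsWalk E _            = ⊤

  isWalk? : ∀ {n e m} {E : Fin n → Fin n → Set e} → (∀ i j → Dec (E i j)) →
            (v : Vec (Fin n) m) → Dec (IsWalk E v)
  isWalk? E? []           = yes _
  isWalk? E? (x ∷ [])     = yes _
  isWalk? E? (x ∷ y ∷ xs) = E? x y ×-dec isWalk? E? (y ∷ xs)

  NonBacktracking : ∀ {n m} → Vec (Fin n) m → Set
  NonBacktracking (x ∷ y ∷ z ∷ xs) = ¬ (x ≡ z) × NonBacktracking (y ∷ z ∷ xs)
  NonBacktracking _                = ⊤

  nonBacktracking? : ∀ {n m} (v : Vec (Fin n) m) → Dec (NonBacktracking v)
  nonBacktracking? []               = yes _
  nonBacktracking? (x ∷ [])         = yes _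
  nonBacktracking? (x ∷ y ∷ [])     = yes _
  nonBacktracking? (x ∷ y ∷ z ∷ xs) = ¬? (x ≟ᶠ z) ×-dec nonBacktracking? (y ∷ z ∷ xs)

  weight : ∀ {n m} → Matrix n → Vec (Fin n) m → Carrier
  weight A (x ∷ y ∷ xs) = A x y * weight A (y ∷ xs)
  weight A _            = 1#

  allVecs : ∀ {n} (m : ℕ) → List (Vec (Fin n) m)
  allVecs {n} zero    = [ [] ]
  allVecs {n} (suc m) = concatMap (λ x → map (x ∷_) (allVecs m)) (allFin n)

  -- nonbacktracking walks of length k (k+1 nodes) from i to j
  IsNBWalk : ∀ {n e k} (E : Fin n → Fin n → Set e) (i j : Fin n) →
             Vec (Fin n) (suc k) → Set e
  IsNBWalk E i j v = (head v ≡ i × last v ≡ j) × (IsWalk E v × NonBacktracking v)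

  isNBWalk? : ∀ {n e k} {E : Fin n → Fin n → Set e} → (∀ i j → Dec (E i j)) →
              (i j : Fin n) (v : Vec (Fin n) (suc k)) → Dec (IsNBWalk E i j v)
  isNBWalk? E? i j v =
    ((head v ≟ᶠ i) ×-dec (last v ≟ᶠ j)) ×-dec (isWalk? E? v ×-dec nonBacktracking? v)

  p : ∀ {n e} (E : Fin n → Fin n → Set e) (E? : ∀ i j → Dec (E i j))
      (Ω : ∀ i j → E i j → Carrier) → ℕ → Matrix n
  p E E? Ω k i j =
    sumList (map (weight (adjacency E E? Ω))
                 (filter (isNBWalk? E? i j) (allVecs (suc k))))

  -- right-hand side of Theorem 3.1
  -- term for ℓ (1 ≤ ℓ ≤ k):  ℓ = 2h+1 odd  ↦  +(A^{∘(h+1)} ∘ (Aᵀ)^{∘h}) p_{k-ℓ}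
  --                          ℓ = 2h even   ↦  -dd((A^{∘h})²) p_{k-ℓ}
  rhs : ∀ {n e} (E : Fin n → Fin n → Set e) (E? : ∀ i j → Dec (E i j))
        (Ω : ∀ i j → E i j → Carrier) → ℕ → Matrix n
  rhs E E? Ω k =
      sumᴹ (map oddTerm (filter (λ ℓ → (ℓ % 2) ℕ.≟ 1) ls))
    -ᴹ sumᴹ (map evenTerm (filter (λ ℓ → (ℓ % 2) ℕ.≟ 0) ls))
    where
      A = adjacency E E? Ω
      ls = map suc (upTo k)
      oddTerm : ℕ → Matrix _
      oddTerm ℓ = (hpow A (suc (ℓ / 2)) ∘ᴹ hpow (transpose A) (ℓ / 2)) ·ᴹ p E E? Ω (k ∸ ℓ)
      evenTerm : ℕ → Matrix _
      evenTerm ℓ = dd (hpow A (ℓ / 2) ·ᴹ hpow A (ℓ / 2)) ·ᴹ p E E? Ω (k ∸ ℓ)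

-- A nonbacktracking walk that has just stepped from a to b continues as any
-- nonbacktracking walk from b, except those whose first step returns to a.
-- Removing those by inclusion–exclusion and iterating, the walks of length k
-- after a → b become an alternating sum over the number t of forced
-- back-and-forth steps along the edge {a, b}: the t-th term carries the
-- weight A_ba A_ab A_ba ⋯ (t factors) times p_{k-t} from b (t even) or from a
-- (t odd). Prepending the first step i → m and summing over m turns the even
-- terms into the Hadamard products A^{∘(h+1)} ∘ (Aᵀ)^{∘h}, and the odd terms,
-- which return to i, into the diagonal of (A^{∘h})².
module Submission where

open import Defs
open import Algebra.Bundles using (CommutativeRing)
open import Data.Nat using (ℕ; suc)
open import Data.Fin using (Fin)
open import Relation.Nullary using (¬_; Dec)

import Algebra.Properties.AbelianGroup as AbelianGroupProperties
import Algebra.Properties.CommutativeSemigroup as CommutativeSemigroupProperties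
import Algebra.Properties.Ring as RingProperties
import Algebra.Properties.Semiring.Sum as SemiringSum
import Algebra.Solver.CommutativeMonoid as CommutativeMonoidSolver
open import Data.Fin using (zero; suc; toℕ) renaming (_≟_ to _≟ᶠ_)
open import Data.List using (List; []; _∷_; _++_; map; concatMap; filter; tabulate; allFin; applyUpTo; upTo)
import Data.List.Properties as List
import Data.Nat as ℕ
open import Data.Nat.DivMod using (_/_; _%_; m*n%n≡0; [m+kn]%n≡m%n; m*n/n≡m; +-distrib-/-∣ʳ)
open import Data.Nat.Divisibility using (divides-refl)
open import Data.Vec using (Vec; []; _∷_; head; last)
open import Function using (_∘_)
open import Relation.Nullary using (yes; no; does; ¬?)
open import Data.Bool using (if_then_else_)
open import Relation.Nullary.Decidable using (_×-dec_)
open import Relation.Unary using (Pred; Decidable)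
open import Relation.Binary.PropositionalEquality as ≡ using (_≡_)
import Relation.Binary.Reasoning.Setoid as SetoidReasoning

data Parity : ℕ → Set where
  even : ∀ h → Parity (h ℕ.* 2)
  odd  : ∀ h → Parity (suc (h ℕ.* 2))

parity : ∀ t → Parity t
parity ℕ.zero = even 0
parity (suc t) with parity t
... | even h = odd h
... | odd h  = even (suc h)

h*2%2≡0 : ∀ h → h ℕ.* 2 % 2 ≡ 0
h*2%2≡0 h = m*n%n≡0 h 2

h*2/2≡h : ∀ h → h ℕ.* 2 / 2 ≡ h
h*2/2≡h h = m*n/n≡m h 2

[1+h*2]%2≡1 : ∀ h → suc (h ℕ.* 2) % 2 ≡ 1
[1+h*2]%2≡1 h = [m+kn]%n≡m%n 1 h 2

[1+h*2]/2≡h : ∀ h → suc (h ℕ.* 2) / 2 ≡ h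
[1+h*2]/2≡h h = ≡.trans (+-distrib-/-∣ʳ 1 {d = 2} (divides-refl h)) (m*n/n≡m h 2)

module RingSums {c ℓ} (R : CommutativeRing c ℓ) where
  open CommutativeRing R hiding (zero)
  open Mat R
  open SemiringSum semiring public
    using (sum; sum-syntax; sum-cong-≋; sum-cong-≗; ∑-distrib-+; ∑-comm; *-distribˡ-sum; *-distribʳ-sum; sum-replicate-zero)
  open RingProperties ring using (-1*x≈-x)
  open AbelianGroupProperties +-abelianGroup using (//-rightDividesʳ; ⁻¹-∙-comm)
  open CommutativeSemigroupProperties +-commutativeSemigroup using (interchange)
  open SetoidReasoning setoid

  -- Defined through 'does' so that 𝟙 (suc a ≟ᶠ suc m) computes to 𝟙 (a ≟ᶠ m).
  𝟙 : ∀ {p} {X : Set p} → Dec X → Carrier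
  𝟙 x? = if does x? then 1# else 0#

  𝟙-cong : ∀ {p q} {X : Set p} {Y : Set q} → (X → Y) → (Y → X) →
           (x? : Dec X) (y? : Dec Y) → 𝟙 x? ≡ 𝟙 y?
  𝟙-cong f g (yes _) (yes _) = ≡.refl
  𝟙-cong f g (no _)  (no _)  = ≡.refl
  𝟙-cong f g (yes x) (no ¬y) with () ← ¬y (f x)
  𝟙-cong f g (no ¬x) (yes y) with () ← ¬x (g y)

  𝟙-× : ∀ {p q} {X : Set p} {Y : Set q} (x? : Dec X) (y? : Dec Y) →
        𝟙 (x? ×-dec y?) ≈ 𝟙 x? * 𝟙 y?
  𝟙-× (yes _) (yes _) = sym (*-identityˡ 1#)
  𝟙-× (yes _) (no _)  = sym (*-identityˡ 0#)
  𝟙-× (no _)  y?      = sym (zeroˡ (𝟙 y?))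

  𝟙-¬+𝟙 : ∀ {p} {X : Set p} (x? : Dec X) → 𝟙 (¬? x?) + 𝟙 x? ≈ 1#
  𝟙-¬+𝟙 (yes _) = +-identityˡ 1#
  𝟙-¬+𝟙 (no _)  = +-identityʳ 1#

  sumFin≡sum : ∀ {n} (f : Fin n → Carrier) → sumFin f ≡ sum f
  sumFin≡sum {ℕ.zero}  f = ≡.refl
  sumFin≡sum {suc n}   f = ≡.cong (f zero +_) (sumFin≡sum (f ∘ suc))

  -‿distrib-sum : ∀ {n} (f : Fin n → Carrier) → - sum f ≈ ∑[ i < n ] (- f i)
  -‿distrib-sum f = begin
    - sum f                  ≈⟨ -1*x≈-x (sum f) ⟨
    - 1# * sum f             ≈⟨ *-distribˡ-sum (- 1#) f ⟩
    ∑[ i < _ ] (- 1# * f i)  ≈⟨ sum-cong-≋ (λ i → -1*x≈-x (f i)) ⟩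
    ∑[ i < _ ] (- f i)       ∎

  sum-𝟙-≟ : ∀ {n} (a : Fin n) (g : Fin n → Carrier) → ∑[ m < n ] (𝟙 (a ≟ᶠ m) * g m) ≈ g a
  sum-𝟙-≟ {suc n} zero g = begin
    1# * g zero + ∑[ m < n ] (0# * g (suc m))  ≈⟨ +-cong (*-identityˡ (g zero)) (sum-cong-≋ (λ m → zeroˡ (g (suc m)))) ⟩
    g zero + ∑[ m < n ] 0#                     ≈⟨ +-congˡ (sum-replicate-zero n) ⟩
    g zero + 0#                                ≈⟨ +-identityʳ (g zero) ⟩
    g zero                                     ∎
  sum-𝟙-≟ {suc n} (suc a) g = begin
    0# * g zero + ∑[ m < n ] (𝟙 (a ≟ᶠ m) * g (suc m))  ≈⟨ +-cong (zeroˡ (g zero)) (sum-𝟙-≟ a (g ∘ suc)) ⟩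
    0# + g (suc a)                                     ≈⟨ +-identityˡ (g (suc a)) ⟩
    g (suc a)                                          ∎

  sum-split : ∀ {n} (a : Fin n) (f : Fin n → Carrier) →
              sum f ≈ ∑[ m < n ] (𝟙 (¬? (a ≟ᶠ m)) * f m) + f a
  sum-split {n} a f = begin
    sum f
      ≈⟨ sum-cong-≋ split ⟩
    ∑[ m < n ] (𝟙 (¬? (a ≟ᶠ m)) * f m + 𝟙 (a ≟ᶠ m) * f m)
      ≈⟨ ∑-distrib-+ (λ m → 𝟙 (¬? (a ≟ᶠ m)) * f m) (λ m → 𝟙 (a ≟ᶠ m) * f m) ⟩
    ∑[ m < n ] (𝟙 (¬? (a ≟ᶠ m)) * f m) + ∑[ m < n ] (𝟙 (a ≟ᶠ m) * f m)
      ≈⟨ +-congˡ (sum-𝟙-≟ a f) ⟩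
    ∑[ m < n ] (𝟙 (¬? (a ≟ᶠ m)) * f m) + f a
      ∎
    where
      split : ∀ m → f m ≈ 𝟙 (¬? (a ≟ᶠ m)) * f m + 𝟙 (a ≟ᶠ m) * f m
      split m = begin
        f m                                          ≈⟨ *-identityˡ (f m) ⟨
        1# * f m                                     ≈⟨ *-congʳ (𝟙-¬+𝟙 (a ≟ᶠ m)) ⟨
        (𝟙 (¬? (a ≟ᶠ m)) + 𝟙 (a ≟ᶠ m)) * f m         ≈⟨ distribʳ (f m) _ _ ⟩
        𝟙 (¬? (a ≟ᶠ m)) * f m + 𝟙 (a ≟ᶠ m) * f m     ∎

  x≈[x+y]-y : ∀ x y → x ≈ (x + y) - y
  x≈[x+y]-y x y = sym (//-rightDividesʳ y x)

  sumList-++ : ∀ xs ys → sumList (xs ++ ys) ≈ sumList xs + sumList ys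
  sumList-++ []       ys = sym (+-identityˡ (sumList ys))
  sumList-++ (x ∷ xs) ys = trans (+-congˡ (sumList-++ xs ys)) (sym (+-assoc x _ _))

  sumList-map-cong : ∀ {a} {X : Set a} {f g : X → Carrier} → (∀ x → f x ≈ g x) →
                     ∀ xs → sumList (map f xs) ≈ sumList (map g xs)
  sumList-map-cong f≈g []       = refl
  sumList-map-cong f≈g (x ∷ xs) = +-cong (f≈g x) (sumList-map-cong f≈g xs)

  *-distribˡ-sumList : ∀ {a} {X : Set a} y (f : X → Carrier) xs →
                       y * sumList (map f xs) ≈ sumList (map (λ x → y * f x) xs)
  *-distribˡ-sumList y f []       = zeroʳ y
  *-distribˡ-sumList y f (x ∷ xs) = trans (distribˡ y (f x) _) (+-congˡ (*-distribˡ-sumList y f xs))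

  sumList-map-concatMap : ∀ {a b} {X : Set a} {Y : Set b} (h : Y → Carrier) (f : X → List Y) xs →
                          sumList (map h (concatMap f xs)) ≈ sumList (map (λ x → sumList (map h (f x))) xs)
  sumList-map-concatMap h f []       = refl
  sumList-map-concatMap h f (x ∷ xs) = begin
    sumList (map h (f x ++ concatMap f xs))
      ≡⟨ ≡.cong sumList (List.map-++ h (f x) (concatMap f xs)) ⟩
    sumList (map h (f x) ++ map h (concatMap f xs))
      ≈⟨ sumList-++ (map h (f x)) _ ⟩
    sumList (map h (f x)) + sumList (map h (concatMap f xs))
      ≈⟨ +-congˡ (sumList-map-concatMap h f xs) ⟩
    sumList (map h (f x)) + sumList (map (λ y → sumList (map h (f y))) xs)
      ∎

  sumList-map-tabulate : ∀ {a n} {X : Set a} (f : X → Carrier) (g : Fin n → X) →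
                         sumList (map f (tabulate g)) ≡ ∑[ i < n ] f (g i)
  sumList-map-tabulate {n = ℕ.zero} f g = ≡.refl
  sumList-map-tabulate {n = suc n}  f g = ≡.cong (f (g zero) +_) (sumList-map-tabulate f (g ∘ suc))

  sumList-map-applyUpTo : ∀ {a} {X : Set a} (f : X → Carrier) (g : ℕ → X) n →
                          sumList (map f (applyUpTo g n)) ≡ ∑[ t < n ] f (g (toℕ t))
  sumList-map-applyUpTo f g ℕ.zero  = ≡.refl
  sumList-map-applyUpTo f g (suc n) = ≡.cong (f (g 0) +_) (sumList-map-applyUpTo f (g ∘ suc) n)

  sumList-filter : ∀ {a p} {X : Set a} {P : Pred X p} (P? : Decidable P) (f : X → Carrier) xs →
                   sumList (map f (filter P? xs)) ≈ sumList (map (λ x → 𝟙 (P? x) * f x) xs)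
  sumList-filter P? f []       = refl
  sumList-filter P? f (x ∷ xs) with P? x
  ... | yes _ = +-cong (sym (*-identityˡ (f x))) (sumList-filter P? f xs)
  ... | no _  = trans (sumList-filter P? f xs) (sym (trans (+-congʳ (zeroˡ (f x))) (+-identityˡ _)))

  sumList-map-− : ∀ {a} {X : Set a} (f g : X → Carrier) xs →
                  sumList (map f xs) - sumList (map g xs) ≈ sumList (map (λ x → f x - g x) xs)
  sumList-map-− f g []       = -‿inverseʳ 0#
  sumList-map-− f g (x ∷ xs) = begin
    (f x + F) - (g x + G)      ≈⟨ +-congˡ (⁻¹-∙-comm (g x) G) ⟨
    (f x + F) + (- g x + - G)  ≈⟨ interchange (f x) F (- g x) (- G) ⟩
    (f x - g x) + (F - G)      ≈⟨ +-congˡ (sumList-map-− f g xs) ⟩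
    (f x - g x) + sumList (map (λ y → f y - g y) xs)  ∎
    where
      F = sumList (map f xs)
      G = sumList (map g xs)

  sumᴹ-map : ∀ {a n} {X : Set a} (F : X → Matrix n) xs i j →
             sumᴹ (map F xs) i j ≡ sumList (map (λ x → F x i j) xs)
  sumᴹ-map F []       i j = ≡.refl
  sumᴹ-map F (x ∷ xs) i j = ≡.cong (F x i j +_) (sumᴹ-map F xs i j)

  ·ᴹ-congˡ : ∀ {n} (M : Matrix n) {N N′ : Matrix n} → N ≈ᴹ N′ → (M ·ᴹ N) ≈ᴹ (M ·ᴹ N′)
  ·ᴹ-congˡ {n} M {N} {N′} N≈N′ i j = begin
    sumFin (λ m → M i m * N m j)   ≡⟨ sumFin≡sum (λ m → M i m * N m j) ⟩
    ∑[ m < n ] (M i m * N m j)     ≈⟨ sum-cong-≋ (λ m → *-congˡ (N≈N′ m j)) ⟩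
    ∑[ m < n ] (M i m * N′ m j)    ≡⟨ sumFin≡sum (λ m → M i m * N′ m j) ⟨
    sumFin (λ m → M i m * N′ m j)  ∎

  dd-·ᴹ : ∀ {n} (M N : Matrix n) i j → (dd M ·ᴹ N) i j ≈ M i i * N i j
  dd-·ᴹ {n} M N i j = begin
    sumFin (λ m → dd M i m * N m j)            ≡⟨ sumFin≡sum (λ m → dd M i m * N m j) ⟩
    ∑[ m < n ] (dd M i m * N m j)              ≈⟨ sum-cong-≋ (λ m → trans (*-congʳ (dd≈𝟙 m)) (*-assoc _ _ _)) ⟩
    ∑[ m < n ] (𝟙 (i ≟ᶠ m) * (M i i * N m j))  ≈⟨ sum-𝟙-≟ i (λ m → M i i * N m j) ⟩
    M i i * N i j                              ∎
    where
      dd≈𝟙 : ∀ m → dd M i m ≈ 𝟙 (i ≟ᶠ m) * M i i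
      dd≈𝟙 m with i ≟ᶠ m
      ... | yes ≡.refl = sym (*-identityˡ (M i i))
      ... | no _       = sym (zeroˡ (M i i))

module NonBacktracking {c ℓ} (R : CommutativeRing c ℓ) {n} (A : Mat.Matrix R n) where
  open CommutativeRing R hiding (zero)
  open Mat R
  open RingSums R
  open RingProperties ring using (-‿distribˡ-*; -‿distribʳ-*; -‿involutive; -0#≈0#)
  open CommutativeMonoidSolver *-commutativeMonoid using (solve; _⊕_; _⊜_)
  open SetoidReasoning setoid

  nbWalksAfter : ℕ → Fin n → Matrix n
  nbWalksAfter ℕ.zero  a b j = 𝟙 (b ≟ᶠ j)
  nbWalksAfter (suc k) a b j = ∑[ m < n ] (𝟙 (¬? (a ≟ᶠ m)) * (A b m * nbWalksAfter k b m j))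

  nbWalks : ℕ → Matrix n
  nbWalks ℕ.zero  b j = 𝟙 (b ≟ᶠ j)
  nbWalks (suc k) b j = ∑[ m < n ] (A b m * nbWalksAfter k b m j)

  nbWalksAfter-suc : ∀ k a b j →
                     nbWalksAfter (suc k) a b j ≈ nbWalks (suc k) b j - A b a * nbWalksAfter k b a j
  nbWalksAfter-suc k a b j = begin
    nbWalksAfter (suc k) a b j                                  ≈⟨ x≈[x+y]-y _ (A b a * nbWalksAfter k b a j) ⟩
    (nbWalksAfter (suc k) a b j + A b a * nbWalksAfter k b a j)
      - A b a * nbWalksAfter k b a j                            ≈⟨ +-congʳ (sum-split a (λ m → A b m * nbWalksAfter k b m j)) ⟨
    nbWalks (suc k) b j - A b a * nbWalksAfter k b a j          ∎

  backtrackCoeff : ℕ → Fin n → Fin n → Carrier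
  backtrackCoeff ℕ.zero  a b = 1#
  backtrackCoeff (suc t) a b = - (A b a * backtrackCoeff t b a)

  backtrackEnd : ℕ → Fin n → Fin n → Fin n
  backtrackEnd ℕ.zero  a b = b
  backtrackEnd (suc t) a b = backtrackEnd t b a

  backtrackTerm : ℕ → ℕ → Fin n → Fin n → Fin n → Carrier
  backtrackTerm k t a b j = backtrackCoeff t a b * nbWalks (k ℕ.∸ t) (backtrackEnd t a b) j

  backtrackTerm-suc : ∀ k t a b j →
                      backtrackTerm (suc k) (suc t) a b j ≈ - (A b a * backtrackTerm k t b a j)
  backtrackTerm-suc k t a b j = trans (sym (-‿distribˡ-* _ _)) (-‿cong (*-assoc _ _ _))

  nbWalksAfter-unfold : ∀ k a b j →
                        nbWalksAfter k a b j ≈ ∑[ t < suc k ] backtrackTerm k (toℕ t) a b j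
  nbWalksAfter-unfold ℕ.zero a b j = sym (trans (+-identityʳ _) (*-identityˡ _))
  nbWalksAfter-unfold (suc k) a b j = begin
    nbWalksAfter (suc k) a b j                                       ≈⟨ nbWalksAfter-suc k a b j ⟩
    nbWalks (suc k) b j - A b a * nbWalksAfter k b a j               ≈⟨ +-congˡ (-‿cong (*-congˡ (nbWalksAfter-unfold k b a j))) ⟩
    nbWalks (suc k) b j - A b a * ∑[ t < suc k ] T t                 ≈⟨ +-congˡ (-‿cong (*-distribˡ-sum (A b a) T)) ⟩
    nbWalks (suc k) b j - ∑[ t < suc k ] (A b a * T t)               ≈⟨ +-congˡ (-‿distrib-sum (λ t → A b a * T t)) ⟩
    nbWalks (suc k) b j + ∑[ t < suc k ] (- (A b a * T t))           ≈⟨ +-cong (*-identityˡ _) (sum-cong-≋ {suc k} (λ t → backtrackTerm-suc k (toℕ t) a b j)) ⟨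
    ∑[ t < suc (suc k) ] backtrackTerm (suc k) (toℕ t) a b j         ∎
    where
      T : Fin (suc k) → Carrier
      T t = backtrackTerm k (toℕ t) b a j

  nbWalks-suc : ∀ k i j →
                nbWalks (suc k) i j ≈ ∑[ t < suc k ] ∑[ m < n ] (A i m * backtrackTerm k (toℕ t) i m j)
  nbWalks-suc k i j = begin
    ∑[ m < n ] (A i m * nbWalksAfter k i m j)                             ≈⟨ sum-cong-≋ (λ m → *-congˡ (nbWalksAfter-unfold k i m j)) ⟩
    ∑[ m < n ] (A i m * ∑[ t < suc k ] backtrackTerm k (toℕ t) i m j)     ≈⟨ sum-cong-≋ (λ m → *-distribˡ-sum {suc k} (A i m) (λ t → backtrackTerm k (toℕ t) i m j)) ⟩
    ∑[ m < n ] ∑[ t < suc k ] (A i m * backtrackTerm k (toℕ t) i m j)     ≈⟨ ∑-comm {n} {suc k} (λ m t → A i m * backtrackTerm k (toℕ t) i m j) ⟩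
    ∑[ t < suc k ] ∑[ m < n ] (A i m * backtrackTerm k (toℕ t) i m j)     ∎

  backtrackEnd-even : ∀ h a b → backtrackEnd (h ℕ.* 2) a b ≡ b
  backtrackEnd-even ℕ.zero  a b = ≡.refl
  backtrackEnd-even (suc h) a b = backtrackEnd-even h a b

  backtrackCoeff-even : ∀ h a b → backtrackCoeff (h ℕ.* 2) a b ≈ pow (A a b) h * pow (A b a) h
  backtrackCoeff-even ℕ.zero  a b = sym (*-identityˡ 1#)
  backtrackCoeff-even (suc h) a b = begin
    - (A b a * - (A a b * backtrackCoeff (h ℕ.* 2) a b))  ≈⟨ -‿cong (-‿distribʳ-* (A b a) _) ⟨
    - - (A b a * (A a b * backtrackCoeff (h ℕ.* 2) a b))  ≈⟨ -‿involutive _ ⟩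
    A b a * (A a b * backtrackCoeff (h ℕ.* 2) a b)        ≈⟨ *-congˡ (*-congˡ (backtrackCoeff-even h a b)) ⟩
    A b a * (A a b * (pow (A a b) h * pow (A b a) h))     ≈⟨ solve 4 (λ x y u v → x ⊕ (y ⊕ (u ⊕ v)) ⊜ (y ⊕ u) ⊕ (x ⊕ v)) refl
                                                               (A b a) (A a b) (pow (A a b) h) (pow (A b a) h) ⟩
    pow (A a b) (suc h) * pow (A b a) (suc h)             ∎

  summand : (ℕ → Matrix n) → ℕ → ℕ → Matrix n
  summand P K l i j =
      𝟙 (l % 2 ℕ.≟ 1) * ((hpow A (suc (l / 2)) ∘ᴹ hpow (transpose A) (l / 2)) ·ᴹ P (K ℕ.∸ l)) i j
    - 𝟙 (l % 2 ℕ.≟ 0) * (dd (hpow A (l / 2) ·ᴹ hpow A (l / 2)) ·ᴹ P (K ℕ.∸ l)) i j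

  summand-cong : ∀ {P Q : ℕ → Matrix n} → (∀ K → P K ≈ᴹ Q K) →
                 ∀ K l i j → summand P K l i j ≈ summand Q K l i j
  summand-cong P≈Q K l i j =
    +-cong (*-congˡ (·ᴹ-congˡ (hpow A (suc (l / 2)) ∘ᴹ hpow (transpose A) (l / 2)) (P≈Q (K ℕ.∸ l)) i j))
           (-‿cong (*-congˡ (·ᴹ-congˡ (dd (hpow A (l / 2) ·ᴹ hpow A (l / 2))) (P≈Q (K ℕ.∸ l)) i j)))

  summand-odd : ∀ P K h i j → summand P K (suc (h ℕ.* 2)) i j ≈
                ((hpow A (suc h) ∘ᴹ hpow (transpose A) h) ·ᴹ P (K ℕ.∸ suc (h ℕ.* 2))) i j
  summand-odd P K h i j rewrite [1+h*2]%2≡1 h | [1+h*2]/2≡h h =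
    trans (+-cong (*-identityˡ _) (trans (-‿cong (zeroˡ _)) -0#≈0#)) (+-identityʳ _)

  summand-even : ∀ P K h i j → summand P K (suc h ℕ.* 2) i j ≈
                 - (dd (hpow A (suc h) ·ᴹ hpow A (suc h)) ·ᴹ P (K ℕ.∸ suc h ℕ.* 2)) i j
  summand-even P K h i j rewrite h*2%2≡0 (suc h) | h*2/2≡h (suc h) =
    trans (+-cong (zeroˡ _) (-‿cong (*-identityˡ _))) (+-identityˡ _)

  ∑backtrackTerm≈summand : ∀ k t i j →
    ∑[ m < n ] (A i m * backtrackTerm k t i m j) ≈ summand nbWalks (suc k) (suc t) i j
  ∑backtrackTerm≈summand k t i j with parity t
  ... | even h = begin
    ∑[ m < n ] (A i m * backtrackTerm k (h ℕ.* 2) i m j)     ≈⟨ sum-cong-≋ term ⟩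
    ∑[ m < n ] (Q m * W m j)                                 ≡⟨ sumFin≡sum (λ m → Q m * W m j) ⟨
    ((hpow A (suc h) ∘ᴹ hpow (transpose A) h) ·ᴹ W) i j      ≈⟨ summand-odd nbWalks (suc k) h i j ⟨
    summand nbWalks (suc k) (suc (h ℕ.* 2)) i j              ∎
    where
      W : Matrix n
      W = nbWalks (k ℕ.∸ h ℕ.* 2)
      Q : Fin n → Carrier
      Q m = pow (A i m) (suc h) * pow (A m i) h
      term : ∀ m → A i m * backtrackTerm k (h ℕ.* 2) i m j ≈ Q m * W m j
      term m rewrite backtrackEnd-even h i m = begin
        A i m * (backtrackCoeff (h ℕ.* 2) i m * W m j)        ≈⟨ *-congˡ (*-congʳ (backtrackCoeff-even h i m)) ⟩
        A i m * ((pow (A i m) h * pow (A m i) h) * W m j)     ≈⟨ solve 4 (λ a x y w → a ⊕ ((x ⊕ y) ⊕ w) ⊜ ((a ⊕ x) ⊕ y) ⊕ w) refl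
                                                                   (A i m) (pow (A i m) h) (pow (A m i) h) (W m j) ⟩
        Q m * W m j                                           ∎
  ... | odd h = begin
    ∑[ m < n ] (A i m * backtrackTerm k (suc (h ℕ.* 2)) i m j)   ≈⟨ sum-cong-≋ term ⟩
    ∑[ m < n ] (- (Q m * W i j))                                 ≈⟨ -‿distrib-sum (λ m → Q m * W i j) ⟨
    - ∑[ m < n ] (Q m * W i j)                                   ≈⟨ -‿cong (*-distribʳ-sum (W i j) Q) ⟨
    - (sum Q * W i j)                                            ≡⟨ ≡.cong (λ x → - (x * W i j)) (sumFin≡sum Q) ⟨
    - (M i i * W i j)                                            ≈⟨ -‿cong (dd-·ᴹ M W i j) ⟨
    - (dd M ·ᴹ W) i j                                            ≈⟨ summand-even nbWalks (suc k) h i j ⟨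
    summand nbWalks (suc k) (suc h ℕ.* 2) i j                    ∎
    where
      W M : Matrix n
      W = nbWalks (k ℕ.∸ suc (h ℕ.* 2))
      M = hpow A (suc h) ·ᴹ hpow A (suc h)
      Q : Fin n → Carrier
      Q m = pow (A i m) (suc h) * pow (A m i) (suc h)
      term : ∀ m → A i m * backtrackTerm k (suc (h ℕ.* 2)) i m j ≈ - (Q m * W i j)
      term m rewrite backtrackEnd-even h m i = begin
        A i m * (- (A m i * backtrackCoeff (h ℕ.* 2) m i) * W i j)  ≈⟨ *-congˡ (-‿distribˡ-* _ (W i j)) ⟨
        A i m * - ((A m i * backtrackCoeff (h ℕ.* 2) m i) * W i j)  ≈⟨ -‿distribʳ-* (A i m) _ ⟨
        - (A i m * ((A m i * backtrackCoeff (h ℕ.* 2) m i) * W i j))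
          ≈⟨ -‿cong (*-congˡ (*-congʳ (*-congˡ (backtrackCoeff-even h m i)))) ⟩
        - (A i m * ((A m i * (pow (A m i) h * pow (A i m) h)) * W i j))
          ≈⟨ -‿cong (solve 5 (λ a b x y w → a ⊕ ((b ⊕ (x ⊕ y)) ⊕ w) ⊜ ((a ⊕ y) ⊕ (b ⊕ x)) ⊕ w) refl
                       (A i m) (A m i) (pow (A m i) h) (pow (A i m) h) (W i j)) ⟩
        - (Q m * W i j)                                              ∎

  nbWalks-suc≈∑summand : ∀ k i j →
    nbWalks (suc k) i j ≈ ∑[ t < suc k ] summand nbWalks (suc k) (suc (toℕ t)) i j
  nbWalks-suc≈∑summand k i j =
    trans (nbWalks-suc k i j) (sum-cong-≋ {suc k} (λ t → ∑backtrackTerm≈summand k (toℕ t) i j))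

module WalkEnumeration {c ℓ e} (R : CommutativeRing c ℓ) {n} (E : Fin n → Fin n → Set e)
                       (E? : ∀ i j → Dec (E i j)) (Ω : ∀ i j → E i j → CommutativeRing.Carrier R) where
  open CommutativeRing R hiding (zero)
  open Mat R
  open RingSums R
  open CommutativeMonoidSolver *-commutativeMonoid using (solve; _⊕_; _⊜_)
  open CommutativeSemigroupProperties *-commutativeSemigroup using (x∙yz≈y∙xz)
  open SetoidReasoning setoid

  A : Matrix n
  A = adjacency E E? Ω

  open NonBacktracking R A

  sumVecs : ∀ m → (Vec (Fin n) m → Carrier) → Carrier
  sumVecs m f = sumList (map f (allVecs m))

  sumVecs-suc : ∀ m (f : Vec (Fin n) (suc m) → Carrier) →
                sumVecs (suc m) f ≈ ∑[ x < n ] sumVecs m (f ∘ (x ∷_))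
  sumVecs-suc m f = begin
    sumList (map f (concatMap (λ x → map (x ∷_) (allVecs m)) (allFin n)))
      ≈⟨ sumList-map-concatMap f (λ x → map (x ∷_) (allVecs m)) (allFin n) ⟩
    sumList (map (λ x → sumList (map f (map (x ∷_) (allVecs m)))) (allFin n))
      ≡⟨ sumList-map-tabulate (λ x → sumList (map f (map (x ∷_) (allVecs m)))) (λ x → x) ⟩
    ∑[ x < n ] sumList (map f (map (x ∷_) (allVecs m)))
      ≡⟨ sum-cong-≗ {n} (λ x → ≡.cong sumList (List.map-∘ (allVecs m))) ⟨
    ∑[ x < n ] sumVecs m (f ∘ (x ∷_))
      ∎

  𝟙-isWalk*weight : ∀ {m} (v : Vec (Fin n) m) → 𝟙 (isWalk? E? v) * weight A v ≈ weight A v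
  𝟙-isWalk*weight []           = *-identityˡ 1#
  𝟙-isWalk*weight (x ∷ [])     = *-identityˡ 1#
  𝟙-isWalk*weight (x ∷ y ∷ xs) with E? x y | 𝟙-isWalk*weight (y ∷ xs)
  ... | yes xy | tail≈ = trans (x∙yz≈y∙xz _ (Ω x y xy) _) (*-congˡ tail≈)
  ... | no _   | _     = trans (zeroˡ _) (sym (zeroˡ _))

  nbWeight : ∀ {m} → Fin n → Vec (Fin n) (suc m) → Carrier
  nbWeight j v = 𝟙 (last v ≟ᶠ j) * (𝟙 (nonBacktracking? v) * weight A v)

  nbWeightAfter : ∀ {m} → Fin n → Fin n → Vec (Fin n) (suc m) → Carrier
  nbWeightAfter j a v = 𝟙 (last v ≟ᶠ j) * (𝟙 (nonBacktracking? (a ∷ v)) * weight A v)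

  sumVecs-nbWeightAfter : ∀ k a b j → sumVecs k (nbWeightAfter j a ∘ (b ∷_)) ≈ nbWalksAfter k a b j
  sumVecs-nbWeightAfter ℕ.zero a b j =
    trans (+-identityʳ _) (trans (*-congˡ (*-identityˡ 1#)) (*-identityʳ _))
  sumVecs-nbWeightAfter (suc k) a b j = begin
    sumVecs (suc k) (nbWeightAfter j a ∘ (b ∷_))
      ≈⟨ sumVecs-suc k _ ⟩
    ∑[ m < n ] sumVecs k (λ u → nbWeightAfter j a (b ∷ m ∷ u))
      ≈⟨ sum-cong-≋ (λ m → sumList-map-cong (step m) (allVecs k)) ⟩
    ∑[ m < n ] sumVecs k (λ u → 𝟙 (¬? (a ≟ᶠ m)) * (A b m * nbWeightAfter j b (m ∷ u)))
      ≈⟨ sum-cong-≋ (λ m → sym (pull m)) ⟩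
    ∑[ m < n ] (𝟙 (¬? (a ≟ᶠ m)) * (A b m * sumVecs k (nbWeightAfter j b ∘ (m ∷_))))
      ≈⟨ sum-cong-≋ (λ m → *-congˡ (*-congˡ (sumVecs-nbWeightAfter k b m j))) ⟩
    nbWalksAfter (suc k) a b j
      ∎
    where
      pull : ∀ m → 𝟙 (¬? (a ≟ᶠ m)) * (A b m * sumVecs k (nbWeightAfter j b ∘ (m ∷_))) ≈
                   sumVecs k (λ u → 𝟙 (¬? (a ≟ᶠ m)) * (A b m * nbWeightAfter j b (m ∷ u)))
      pull m = begin
        𝟙 (¬? (a ≟ᶠ m)) * (A b m * sumVecs k (nbWeightAfter j b ∘ (m ∷_)))
          ≈⟨ *-congˡ (*-distribˡ-sumList (A b m) (nbWeightAfter j b ∘ (m ∷_)) (allVecs k)) ⟩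
        𝟙 (¬? (a ≟ᶠ m)) * sumVecs k (λ u → A b m * nbWeightAfter j b (m ∷ u))
          ≈⟨ *-distribˡ-sumList (𝟙 (¬? (a ≟ᶠ m))) (λ u → A b m * nbWeightAfter j b (m ∷ u)) (allVecs k) ⟩
        sumVecs k (λ u → 𝟙 (¬? (a ≟ᶠ m)) * (A b m * nbWeightAfter j b (m ∷ u)))
          ∎
      step : ∀ m (u : Vec (Fin n) k) →
             nbWeightAfter j a (b ∷ m ∷ u) ≈ 𝟙 (¬? (a ≟ᶠ m)) * (A b m * nbWeightAfter j b (m ∷ u))
      step m u = trans (*-congˡ (*-congʳ (𝟙-× (¬? (a ≟ᶠ m)) (nonBacktracking? (b ∷ m ∷ u)))))
        (solve 5 (λ l x y w v → l ⊕ ((x ⊕ y) ⊕ (w ⊕ v)) ⊜ x ⊕ (w ⊕ (l ⊕ (y ⊕ v)))) refl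
           (𝟙 (last (m ∷ u) ≟ᶠ j)) (𝟙 (¬? (a ≟ᶠ m))) (𝟙 (nonBacktracking? (b ∷ m ∷ u))) (A b m) (weight A (m ∷ u)))

  sumVecs-nbWeight : ∀ k b j → sumVecs k (nbWeight j ∘ (b ∷_)) ≈ nbWalks k b j
  sumVecs-nbWeight ℕ.zero b j =
    trans (+-identityʳ _) (trans (*-congˡ (*-identityˡ 1#)) (*-identityʳ _))
  sumVecs-nbWeight (suc k) b j = begin
    sumVecs (suc k) (nbWeight j ∘ (b ∷_))                              ≈⟨ sumVecs-suc k _ ⟩
    ∑[ m < n ] sumVecs k (λ u → nbWeight j (b ∷ m ∷ u))                ≈⟨ sum-cong-≋ (λ m → sumList-map-cong (step m) (allVecs k)) ⟩
    ∑[ m < n ] sumVecs k (λ u → A b m * nbWeightAfter j b (m ∷ u))     ≈⟨ sum-cong-≋ (λ m → sym (*-distribˡ-sumList (A b m) _ (allVecs k))) ⟩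
    ∑[ m < n ] (A b m * sumVecs k (nbWeightAfter j b ∘ (m ∷_)))        ≈⟨ sum-cong-≋ (λ m → *-congˡ (sumVecs-nbWeightAfter k b m j)) ⟩
    nbWalks (suc k) b j                                                ∎
    where
      step : ∀ m (u : Vec (Fin n) k) → nbWeight j (b ∷ m ∷ u) ≈ A b m * nbWeightAfter j b (m ∷ u)
      step m u = solve 4 (λ l y w v → l ⊕ (y ⊕ (w ⊕ v)) ⊜ w ⊕ (l ⊕ (y ⊕ v))) refl
        (𝟙 (last (m ∷ u) ≟ᶠ j)) (𝟙 (nonBacktracking? (b ∷ m ∷ u))) (A b m) (weight A (m ∷ u))

  p≈nbWalks : ∀ k → p E E? Ω k ≈ᴹ nbWalks k
  p≈nbWalks k i j = begin
    p E E? Ω k i j                                                  ≈⟨ sumList-filter (isNBWalk? E? i j) (weight A) (allVecs (suc k)) ⟩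
    sumVecs (suc k) (λ v → 𝟙 (isNBWalk? E? i j v) * weight A v)     ≈⟨ sumList-map-cong factor (allVecs (suc k)) ⟩
    sumVecs (suc k) (λ v → 𝟙 (head v ≟ᶠ i) * nbWeight j v)          ≈⟨ sumVecs-suc k _ ⟩
    ∑[ x < n ] sumVecs k (λ u → 𝟙 (x ≟ᶠ i) * nbWeight j (x ∷ u))    ≈⟨ sum-cong-≋ (λ x → sym (*-distribˡ-sumList (𝟙 (x ≟ᶠ i)) _ (allVecs k))) ⟩
    ∑[ x < n ] (𝟙 (x ≟ᶠ i) * sumVecs k (nbWeight j ∘ (x ∷_)))       ≡⟨ sum-cong-≗ {n} (λ x → ≡.cong (_* _) (𝟙-cong ≡.sym ≡.sym (x ≟ᶠ i) (i ≟ᶠ x))) ⟩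
    ∑[ x < n ] (𝟙 (i ≟ᶠ x) * sumVecs k (nbWeight j ∘ (x ∷_)))       ≈⟨ sum-𝟙-≟ i (λ x → sumVecs k (nbWeight j ∘ (x ∷_))) ⟩
    sumVecs k (nbWeight j ∘ (i ∷_))                                 ≈⟨ sumVecs-nbWeight k i j ⟩
    nbWalks k i j                                                   ∎
    where
      factor : ∀ v → 𝟙 (isNBWalk? E? i j v) * weight A v ≈ 𝟙 (head v ≟ᶠ i) * nbWeight j v
      factor v = begin
        𝟙 (isNBWalk? E? i j v) * weight A v                           ≈⟨ *-congʳ 𝟙-isNBWalk ⟩
        (𝟙 (head v ≟ᶠ i) * 𝟙 (last v ≟ᶠ j)) * (𝟙 (isWalk? E? v) * 𝟙 (nonBacktracking? v)) * weight A v
          ≈⟨ solve 5 (λ h l w b x → ((h ⊕ l) ⊕ (w ⊕ b)) ⊕ x ⊜ h ⊕ (l ⊕ (b ⊕ (w ⊕ x)))) refl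
               (𝟙 (head v ≟ᶠ i)) (𝟙 (last v ≟ᶠ j)) (𝟙 (isWalk? E? v)) (𝟙 (nonBacktracking? v)) (weight A v) ⟩
        𝟙 (head v ≟ᶠ i) * (𝟙 (last v ≟ᶠ j) * (𝟙 (nonBacktracking? v) * (𝟙 (isWalk? E? v) * weight A v)))
          ≈⟨ *-congˡ (*-congˡ (*-congˡ (𝟙-isWalk*weight v))) ⟩
        𝟙 (head v ≟ᶠ i) * nbWeight j v                                ∎
        where
          𝟙-isNBWalk : 𝟙 (isNBWalk? E? i j v) ≈
                       (𝟙 (head v ≟ᶠ i) * 𝟙 (last v ≟ᶠ j)) * (𝟙 (isWalk? E? v) * 𝟙 (nonBacktracking? v))
          𝟙-isNBWalk = trans (𝟙-× ((head v ≟ᶠ i) ×-dec (last v ≟ᶠ j)) (isWalk? E? v ×-dec nonBacktracking? v))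
                             (*-cong (𝟙-× (head v ≟ᶠ i) (last v ≟ᶠ j)) (𝟙-× (isWalk? E? v) (nonBacktracking? v)))

  rhs≈∑summand : ∀ K i j → rhs E E? Ω K i j ≈ ∑[ t < K ] summand (p E E? Ω) K (suc (toℕ t)) i j
  rhs≈∑summand K i j = begin
    rhs E E? Ω K i j
      ≡⟨ ≡.cong₂ _-_ (sumᴹ-map oddTerm (filter odd? ls) i j) (sumᴹ-map evenTerm (filter even? ls) i j) ⟩
    sumList (map (λ l → oddTerm l i j) (filter odd? ls)) - sumList (map (λ l → evenTerm l i j) (filter even? ls))
      ≈⟨ +-cong (sumList-filter odd? (λ l → oddTerm l i j) ls) (-‿cong (sumList-filter even? (λ l → evenTerm l i j) ls)) ⟩
    sumList (map (λ l → 𝟙 (odd? l) * oddTerm l i j) ls) - sumList (map (λ l → 𝟙 (even? l) * evenTerm l i j) ls)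
      ≈⟨ sumList-map-− _ _ ls ⟩
    sumList (map (λ l → summand P K l i j) (map suc (upTo K)))
      ≡⟨ ≡.cong sumList (List.map-∘ (upTo K)) ⟨
    sumList (map (λ t → summand P K (suc t) i j) (upTo K))
      ≡⟨ sumList-map-applyUpTo (λ t → summand P K (suc t) i j) (λ t → t) K ⟩
    ∑[ t < K ] summand P K (suc (toℕ t)) i j
      ∎
    where
      P : ℕ → Matrix n
      P = p E E? Ω
      ls : List ℕ
      ls = map suc (upTo K)
      odd? : (l : ℕ) → Dec (l % 2 ≡ 1)
      odd? l = l % 2 ℕ.≟ 1
      even? : (l : ℕ) → Dec (l % 2 ≡ 0)
      even? l = l % 2 ℕ.≟ 0
      oddTerm evenTerm : ℕ → Matrix n
      oddTerm l = (hpow A (suc (l / 2)) ∘ᴹ hpow (transpose A) (l / 2)) ·ᴹ P (K ℕ.∸ l)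
      evenTerm l = dd (hpow A (l / 2) ·ᴹ hpow A (l / 2)) ·ᴹ P (K ℕ.∸ l)

theorem3p1 : ∀ {c ℓ e} (R : CommutativeRing c ℓ) (n : ℕ)
               (E : Fin n → Fin n → Set e) (E? : ∀ i j → Dec (E i j))
               (Ω : ∀ i j → E i j → CommutativeRing.Carrier R) →
               (∀ i → ¬ E i i) →
               ∀ (k : ℕ) → Mat._≈ᴹ_ R (Mat.p R E E? Ω (suc k)) (Mat.rhs R E E? Ω (suc k))
theorem3p1 R n E E? Ω _ k i j = begin
  p E E? Ω (suc k) i j                                          ≈⟨ p≈nbWalks (suc k) i j ⟩
  nbWalks (suc k) i j                                           ≈⟨ nbWalks-suc≈∑summand k i j ⟩
  ∑[ t < suc k ] summand nbWalks (suc k) (suc (toℕ t)) i j      ≈⟨ sum-cong-≋ {suc k} (λ t → summand-cong p≈nbWalks (suc k) (suc (toℕ t)) i j) ⟨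
  ∑[ t < suc k ] summand (p E E? Ω) (suc k) (suc (toℕ t)) i j   ≈⟨ rhs≈∑summand (suc k) i j ⟨
  rhs E E? Ω (suc k) i j                                        ∎
  where
    open CommutativeRing R using (setoid)
    open Mat R using (p; rhs)
    open RingSums R using (sum-syntax; sum-cong-≋)
    open WalkEnumeration R E E? Ω using (A; p≈nbWalks; rhs≈∑summand)
    open NonBacktracking R A using (nbWalks; nbWalks-suc≈∑summand; summand; summand-cong)
    open SetoidReasoning setoid
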